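{- Let $n$ be a nonnegative integer and $\alpha\ge1$. If $p$ is an odd prime and $0\le j<p^\alpha$, then $$\sum_{\substack{0\le m\le n\\ m\equiv j\pmod{p^\alpha}}}(-1)^{\frac{m-j}{p^\alpha}}\binom{n}{m}\equiv 0\pmod{p^f},\qquad f=\left\lfloor\frac{n}{2p^\alpha}\right\rceil+\left\lfloor\frac{n}{2p^{\alpha+1}}\right\rceil+\cdots.$$ Similarly, for $0\le j<2^\alpha$, $$\sum_{\substack{0\le m\le n\\ m\equiv j\pmod{2^\alpha}}}(-1)^{\frac{m-j}{2^\alpha}}\binom{n}{m}\equiv 0\pmod{2^{\left\lfloor\frac{n}{2^{\alpha+1}}\right\rceil}}.$$
   Context: $\lfloor x\rceil$ denotes the nonnegative integer closest to $x\in\mathbb{R}$, with $\lfloor x\rceil=0$ for all $x<1/2$ and $\lfloor N+\tfrac12\rceil=N+1$ for $N\in\mathbb{Z}_{\ge0}$. The sum defining $f$ is $\sum_{t\ge0}\lfloor n/(2p^{\alpha+t})\rceil$, which has finitely many nonzero terms. -}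

module Defs where

open import Data.Nat using (ℕ; zero; suc; _+_; _*_; _∸_; _^_; _/_; _%_; _≟_; _<_)
open import Data.Nat.Combinatorics using (_C_)
open import Data.Integer as ℤ using (ℤ; +_; -_)
open import Data.List using (List; []; _∷_; upTo; map)
open import Data.Nat.ListAction using (sum)
open import Relation.Nullary using (yes; no)

-- roundDiv a b = ⌊ a / b ⌉, the nonnegative integer nearest to a/b, with
-- halves rounded up (⌊N + 1/2⌉ = N + 1).  Defined for b = 0 as 0 (never used).
roundDiv : ℕ → ℕ → ℕ
roundDiv a zero    = 0
roundDiv a (suc k) = (2 * a + suc k) / (2 * suc k)

-- f(n, p, α) = Σ_{t ≥ 0} ⌊ n / (2 p^(α+t)) ⌉.  For a prime p (p ≥ 2) and t ≥ n
-- the terms vanish (2 p^(α+t) > 4n), so summing t = 0..n gives the full sum.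
fExp : ℕ → ℕ → ℕ → ℕ
fExp n p α = sum (map (λ t → roundDiv n (2 * p ^ (α + t))) (upTo (suc n)))

sgn : ℕ → ℤ
sgn zero          = + 1
sgn (suc zero)    = - (+ 1)
sgn (suc (suc k)) = sgn k

-- For m ≡ j (mod q) with j < q and m ≥ 0 we have m ≥ j and (m - j)/q = m / q
-- (exact), which is how the exponent is computed.
altSum : (n q j : ℕ) → ℤ
altSum n zero    j = + 0
altSum n (suc k) j = sum' (map term (upTo (suc n)))
  where
  sum' : List ℤ → ℤ
  sum' [] = + 0
  sum' (x ∷ xs) = x ℤ.+ sum' xs
  term : ℕ → ℤ
  term m with m % suc k ≟ j
  ... | yes _ = sgn ((m ∸ j) / suc k) ℤ.* + (n C m)
  ... | no  _ = + 0

{-# OPTIONS --safe #-}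
-- Let S be the shift of integer sequences and w the q-antiperiodic sequence (w(m + q) = -w(m))
-- equal to (-1)^((m - j)/q) at m ≡ j (mod q) and to 0 elsewhere, so that the alternating sum is
-- ((1 + S)^n w)(0).  On q-antiperiodic sequences S^q = -1, so (1 + S)^q acts as the sum of the
-- C(q,i) S^i over 0 < i < q; for q = p^α all these coefficients are divisible by p, hence
-- p^⌊n/q⌋ divides the sum.  Both exponents of the theorem are at most ⌊n/p^α⌋: with
-- N = ⌊n/Q⌋ one has ⌊n/(2Q)⌉ = ⌈N/2⌉ ≤ N - ⌊N/p⌋ = N - ⌊n/(pQ)⌋, and the sum f telescopes.
module Submission where

open import Defs
open import Data.Nat using (ℕ; _^_; _<_; _≤_; _*_; _+_)
open import Data.Nat.Primality using (Prime)
open import Data.Integer using (+_)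
open import Data.Integer.Divisibility using (_∣_)
open import Data.Product using (_×_)
open import Relation.Nullary using (¬_)
open import Relation.Binary.PropositionalEquality using (_≡_)

open import Data.Nat
  using (zero; suc; _∸_; _/_; _%_; _≟_; NonZero; z≤n; s≤s; ⌊_/2⌋; ⌈_/2⌉; >-nonZero; nonTrivial⇒n>1)
open import Data.Nat.Properties
open import Data.Nat.DivMod
open import Data.Nat.Combinatorics using (_C_; nC1≡n; nCn≡1; k>n⇒nCk≡0; nCk+nC[k+1]≡[n+1]C[k+1])
open import Data.Nat.Primality using (euclidsLemma; prime⇒nonZero; prime⇒nonTrivial; prime[2])
import Data.Nat.Divisibility as ℕ
open import Data.Nat.ListAction using (sum)
open import Data.Integer as ℤ using (ℤ)
import Data.Integer.Properties as ℤP
import Data.Integer.Divisibility.Signed as Signed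
open import Algebra.Properties.CommutativeSemigroup ℤP.+-commutativeSemigroup
  using () renaming (interchange to +-interchange; x∙yz≈xz∙y to x+[y+z]≡[x+z]+y; x∙yz≈y∙xz to x+[y+z]≡y+[x+z])
open import Algebra.Properties.CommutativeSemigroup ℤP.*-commutativeSemigroup
  using () renaming (interchange to *-interchange)
open import Data.List using (List; _∷_; applyUpTo)
open import Data.List.Properties using (map-upTo)
open import Data.Product using (_,_)
open import Data.Sum using (inj₁; inj₂)
open import Function using (_∘_)
open import Relation.Nullary using (yes; no; contradiction)
open import Relation.Binary.PropositionalEquality
  using (refl; sym; trans; cong; cong₂; subst; subst₂; module ≡-Reasoning)

∑ : ℕ → (ℕ → ℤ) → ℤ
∑ zero    f = + 0
∑ (suc r) f = f 0 ℤ.+ ∑ r (f ∘ suc)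

∑-cong : ∀ r {f g : ℕ → ℤ} → (∀ i → f i ≡ g i) → ∑ r f ≡ ∑ r g
∑-cong zero    f≗g = refl
∑-cong (suc r) f≗g = cong₂ ℤ._+_ (f≗g 0) (∑-cong r (f≗g ∘ suc))

∑-distrib-+ : ∀ r (f g : ℕ → ℤ) → ∑ r (λ i → f i ℤ.+ g i) ≡ ∑ r f ℤ.+ ∑ r g
∑-distrib-+ zero    f g = refl
∑-distrib-+ (suc r) f g =
  trans (cong (ℤ._+_ (f 0 ℤ.+ g 0)) (∑-distrib-+ r (f ∘ suc) (g ∘ suc)))
        (+-interchange (f 0) (g 0) (∑ r (f ∘ suc)) (∑ r (g ∘ suc)))

∑-last : ∀ r (f : ℕ → ℤ) → ∑ (suc r) f ≡ ∑ r f ℤ.+ f r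
∑-last zero    f = ℤP.+-comm (f 0) (+ 0)
∑-last (suc r) f =
  trans (cong (ℤ._+_ (f 0)) (∑-last r (f ∘ suc))) (sym (ℤP.+-assoc (f 0) (∑ r (f ∘ suc)) (f (suc r))))

∣-∑ : ∀ r {d} {f : ℕ → ℤ} → (∀ i → i < r → d Signed.∣ f i) → d Signed.∣ ∑ r f
∣-∑ zero    d∣f = Signed.∣ᵤ⇒∣ (ℕ._∣0 _)
∣-∑ (suc r) d∣f = Signed.∣m∣n⇒∣m+n (d∣f 0 (s≤s z≤n)) (∣-∑ r (λ i i<r → d∣f (suc i) (s≤s i<r)))

*-pres-∣ : ∀ {i j m n} → i Signed.∣ m → j Signed.∣ n → i ℤ.* j Signed.∣ m ℤ.* n
*-pres-∣ {i} {j} (Signed.divides a refl) (Signed.divides b refl) =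
  Signed.divides (a ℤ.* b) (*-interchange a i b j)

-- ((1 + S)^n w)(m), where S is the shift (S w)(m) = w(m + 1).
binomialSum : (ℕ → ℤ) → ℕ → ℕ → ℤ
binomialSum w n m = ∑ (suc n) (λ i → w (m + i) ℤ.* + (n C i))

module _ (w : ℕ → ℤ) where

  binomialSum-zero : ∀ m → binomialSum w 0 m ≡ w m
  binomialSum-zero m =
    trans (ℤP.+-identityʳ _) (trans (ℤP.*-identityʳ _) (cong w (+-identityʳ m)))

  ∑[n+2]≡binomialSum : ∀ n m → ∑ (suc (suc n)) (λ i → w (m + i) ℤ.* + (n C i)) ≡ binomialSum w n m
  ∑[n+2]≡binomialSum n m = begin
    ∑ (suc (suc n)) (λ i → w (m + i) ℤ.* + (n C i))
      ≡⟨ ∑-last (suc n) (λ i → w (m + i) ℤ.* + (n C i)) ⟩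
    binomialSum w n m ℤ.+ w (m + suc n) ℤ.* + (n C suc n)
      ≡⟨ cong (λ c → binomialSum w n m ℤ.+ w (m + suc n) ℤ.* + c) (k>n⇒nCk≡0 (n<1+n n)) ⟩
    binomialSum w n m ℤ.+ w (m + suc n) ℤ.* + 0
      ≡⟨ cong (ℤ._+_ (binomialSum w n m)) (ℤP.*-zeroʳ (w (m + suc n))) ⟩
    binomialSum w n m ℤ.+ + 0
      ≡⟨ ℤP.+-identityʳ _ ⟩
    binomialSum w n m ∎
    where open ≡-Reasoning

  binomialSum-suc : ∀ n m → binomialSum w (suc n) m ≡ binomialSum w n m ℤ.+ binomialSum w n (suc m)
  binomialSum-suc n m = begin
    binomialSum w (suc n) m
      ≡⟨ cong (ℤ._+_ (w (m + 0) ℤ.* + 1)) (∑-cong (suc n) pascal) ⟩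
    w (m + 0) ℤ.* + 1 ℤ.+ ∑ (suc n) (λ i → w (suc m + i) ℤ.* + (n C i) ℤ.+ inner i)
      ≡⟨ cong (ℤ._+_ (w (m + 0) ℤ.* + 1)) (∑-distrib-+ (suc n) (λ i → w (suc m + i) ℤ.* + (n C i)) inner) ⟩
    w (m + 0) ℤ.* + 1 ℤ.+ (binomialSum w n (suc m) ℤ.+ ∑ (suc n) inner)
      ≡⟨ x+[y+z]≡[x+z]+y (w (m + 0) ℤ.* + 1) (binomialSum w n (suc m)) (∑ (suc n) inner) ⟩
    ∑ (suc (suc n)) (λ i → w (m + i) ℤ.* + (n C i)) ℤ.+ binomialSum w n (suc m)
      ≡⟨ cong (ℤ._+ binomialSum w n (suc m)) (∑[n+2]≡binomialSum n m) ⟩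
    binomialSum w n m ℤ.+ binomialSum w n (suc m) ∎
    where
    open ≡-Reasoning
    inner : ℕ → ℤ
    inner i = w (m + suc i) ℤ.* + (n C suc i)
    pascal : ∀ i → w (m + suc i) ℤ.* + (suc n C suc i) ≡ w (suc m + i) ℤ.* + (n C i) ℤ.+ inner i
    pascal i = begin
      w (m + suc i) ℤ.* + (suc n C suc i)
        ≡⟨ cong (λ c → w (m + suc i) ℤ.* + c) (nCk+nC[k+1]≡[n+1]C[k+1] n i) ⟨
      w (m + suc i) ℤ.* + (n C i + n C suc i)
        ≡⟨ cong (w (m + suc i) ℤ.*_) (ℤP.pos-+ (n C i) (n C suc i)) ⟩
      w (m + suc i) ℤ.* (+ (n C i) ℤ.+ + (n C suc i))
        ≡⟨ ℤP.*-distribˡ-+ (w (m + suc i)) (+ (n C i)) (+ (n C suc i)) ⟩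
      w (m + suc i) ℤ.* + (n C i) ℤ.+ inner i
        ≡⟨ cong (λ k → w k ℤ.* + (n C i) ℤ.+ inner i) (+-suc m i) ⟩
      w (suc m + i) ℤ.* + (n C i) ℤ.+ inner i ∎

binomialSum-+ : ∀ w n r m → binomialSum w (n + r) m ≡ binomialSum (binomialSum w n) r m
binomialSum-+ w n zero m =
  trans (cong (λ k → binomialSum w k m) (+-identityʳ n)) (sym (binomialSum-zero (binomialSum w n) m))
binomialSum-+ w n (suc r) m = begin
  binomialSum w (n + suc r) m
    ≡⟨ cong (λ k → binomialSum w k m) (+-suc n r) ⟩
  binomialSum w (suc (n + r)) m
    ≡⟨ binomialSum-suc w (n + r) m ⟩
  binomialSum w (n + r) m ℤ.+ binomialSum w (n + r) (suc m)
    ≡⟨ cong₂ ℤ._+_ (binomialSum-+ w n r m) (binomialSum-+ w n r (suc m)) ⟩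
  binomialSum (binomialSum w n) r m ℤ.+ binomialSum (binomialSum w n) r (suc m)
    ≡⟨ binomialSum-suc (binomialSum w n) r m ⟨
  binomialSum (binomialSum w n) (suc r) m ∎
  where open ≡-Reasoning

AntiPeriodic : ℕ → (ℕ → ℤ) → Set
AntiPeriodic q w = ∀ x → w (x + q) ≡ ℤ.- w x

binomialSum-antiPeriodic : ∀ {q w} → AntiPeriodic q w → ∀ n → AntiPeriodic q (binomialSum w n)
binomialSum-antiPeriodic {q} {w} w-anti zero x =
  trans (binomialSum-zero w (x + q))
        (trans (w-anti x) (cong ℤ.-_ (sym (binomialSum-zero w x))))
binomialSum-antiPeriodic {q} {w} w-anti (suc n) x = begin
  binomialSum w (suc n) (x + q)
    ≡⟨ binomialSum-suc w n (x + q) ⟩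
  binomialSum w n (x + q) ℤ.+ binomialSum w n (suc x + q)
    ≡⟨ cong₂ ℤ._+_ (binomialSum-antiPeriodic w-anti n x) (binomialSum-antiPeriodic w-anti n (suc x)) ⟩
  ℤ.- binomialSum w n x ℤ.+ ℤ.- binomialSum w n (suc x)
    ≡⟨ ℤP.neg-distrib-+ (binomialSum w n x) (binomialSum w n (suc x)) ⟨
  ℤ.- (binomialSum w n x ℤ.+ binomialSum w n (suc x))
    ≡⟨ cong ℤ.-_ (binomialSum-suc w n x) ⟨
  ℤ.- binomialSum w (suc n) x ∎
  where open ≡-Reasoning

-- For an antiperiod q the end terms C(q,0) v(m) and C(q,q) v(m + q) cancel.
binomialSum-antiPeriod : ∀ {k v} → AntiPeriodic (suc k) v → ∀ m →
  binomialSum v (suc k) m ≡ ∑ k (λ i → v (m + suc i) ℤ.* + (suc k C suc i))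
binomialSum-antiPeriod {k} {v} v-anti m = begin
  v (m + 0) ℤ.* + 1 ℤ.+ ∑ (suc k) inner
    ≡⟨ cong₂ ℤ._+_ (ℤP.*-identityʳ (v (m + 0))) (∑-last k inner) ⟩
  v (m + 0) ℤ.+ (∑ k inner ℤ.+ v (m + suc k) ℤ.* + (suc k C suc k))
    ≡⟨ cong₂ (λ a c → v a ℤ.+ (∑ k inner ℤ.+ v (m + suc k) ℤ.* + c)) (+-identityʳ m) (nCn≡1 (suc k)) ⟩
  v m ℤ.+ (∑ k inner ℤ.+ v (m + suc k) ℤ.* + 1)
    ≡⟨ cong (λ a → v m ℤ.+ (∑ k inner ℤ.+ a)) (trans (ℤP.*-identityʳ _) (v-anti m)) ⟩
  v m ℤ.+ (∑ k inner ℤ.+ ℤ.- v m)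
    ≡⟨ x+[y+z]≡y+[x+z] (v m) (∑ k inner) (ℤ.- v m) ⟩
  ∑ k inner ℤ.+ (v m ℤ.+ ℤ.- v m)
    ≡⟨ cong (ℤ._+_ (∑ k inner)) (ℤP.+-inverseʳ (v m)) ⟩
  ∑ k inner ℤ.+ + 0
    ≡⟨ ℤP.+-identityʳ _ ⟩
  ∑ k inner ∎
  where
  open ≡-Reasoning
  inner : ℕ → ℤ
  inner i = v (m + suc i) ℤ.* + (suc k C suc i)

DividesInnerBinomials : ℕ → ℕ → Set
DividesInnerBinomials p q = ∀ {i} → 0 < i → i < q → p ℕ.∣ q C i

binomialSum-antiPeriod-∣ : ∀ {k v d p} → AntiPeriodic (suc k) v → DividesInnerBinomials p (suc k) →
  (∀ x → d Signed.∣ v x) → ∀ m → d ℤ.* + p Signed.∣ binomialSum v (suc k) m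
binomialSum-antiPeriod-∣ {k} v-anti p∣C d∣v m =
  subst (_ Signed.∣_) (sym (binomialSum-antiPeriod v-anti m))
    (∣-∑ k (λ i i<k → *-pres-∣ (d∣v _) (Signed.∣ᵤ⇒∣ (p∣C (s≤s z≤n) (s≤s i<k)))))

p^t∣binomialSum[r+t*q] : ∀ {q w p} .{{_ : NonZero q}} → AntiPeriodic q w → DividesInnerBinomials p q →
  ∀ t r m → + (p ^ t) Signed.∣ binomialSum w (r + t * q) m
p^t∣binomialSum[r+t*q] w-anti p∣C zero r m = Signed.∣ᵤ⇒∣ (ℕ.1∣ _)
p^t∣binomialSum[r+t*q] {q@(suc k)} {w} {p} w-anti p∣C (suc t) r m =
  subst₂ Signed._∣_ p^t*p≡p^[1+t] (sym shift)
    (binomialSum-antiPeriod-∣ (binomialSum-antiPeriodic w-anti (r + t * q)) p∣C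
      (p^t∣binomialSum[r+t*q] w-anti p∣C t r) m)
  where
  p^t*p≡p^[1+t] : + (p ^ t) ℤ.* + p ≡ + (p ^ suc t)
  p^t*p≡p^[1+t] = trans (sym (ℤP.pos-* (p ^ t) p)) (cong +_ (*-comm (p ^ t) p))
  shift : binomialSum w (r + suc t * q) m ≡ binomialSum (binomialSum w (r + t * q)) q m
  shift = trans (cong (λ n → binomialSum w n m)
                      (trans (cong (_+_ r) (+-comm q (t * q))) (sym (+-assoc r (t * q) q))))
                (binomialSum-+ w (r + t * q) q m)

p^t∣binomialSum : ∀ {q w p t n} .{{_ : NonZero q}} → AntiPeriodic q w → DividesInnerBinomials p q →
  t * q ≤ n → ∀ m → + (p ^ t) Signed.∣ binomialSum w n m
p^t∣binomialSum {q} {w} {p} {t} {n} w-anti p∣C t*q≤n m =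
  subst (λ k → + (p ^ t) Signed.∣ binomialSum w k m) (m∸n+n≡m t*q≤n)
    (p^t∣binomialSum[r+t*q] w-anti p∣C t (n ∸ t * q) m)

[m+n]/n≡1+m/n : ∀ m n .{{_ : NonZero n}} → (m + n) / n ≡ suc (m / n)
[m+n]/n≡1+m/n m n =
  trans (m/n≡1+[m∸n]/n (m≤n+m n m)) (cong (λ k → suc (k / n)) (m+n∸n≡m m n))

sgn-suc : ∀ y → sgn (suc y) ≡ ℤ.- sgn y
sgn-suc zero          = refl
sgn-suc (suc zero)    = refl
sgn-suc (suc (suc y)) = sgn-suc y

signedIndicator : (q j : ℕ) .{{_ : NonZero q}} → ℕ → ℤ
signedIndicator q j m with m % q ≟ j
... | yes _ = sgn ((m ∸ j) / q)
... | no  _ = + 0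

signedIndicator-antiPeriodic : ∀ q j .{{_ : NonZero q}} → AntiPeriodic q (signedIndicator q j)
signedIndicator-antiPeriodic q j x with x % q ≟ j | (x + q) % q ≟ j
... | no  _       | no  _         = refl
... | yes x%q≡j   | no  [x+q]%q≢j = contradiction (trans ([m+n]%n≡m%n x q) x%q≡j) [x+q]%q≢j
... | no  x%q≢j   | yes [x+q]%q≡j = contradiction (trans (sym ([m+n]%n≡m%n x q)) [x+q]%q≡j) x%q≢j
... | yes x%q≡j   | yes _         = begin
  sgn ((x + q ∸ j) / q)   ≡⟨ cong (λ k → sgn (k / q)) (+-∸-comm q j≤x) ⟩
  sgn ((x ∸ j + q) / q)   ≡⟨ cong sgn ([m+n]/n≡1+m/n (x ∸ j) q) ⟩
  sgn (suc ((x ∸ j) / q)) ≡⟨ sgn-suc ((x ∸ j) / q) ⟩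
  ℤ.- sgn ((x ∸ j) / q)   ∎
  where
  open ≡-Reasoning
  j≤x : j ≤ x
  j≤x = subst (_≤ x) x%q≡j (m%n≤m x q)

-- The summation inside `altSum` runs through functions local to its where-block, which cannot be
-- named; `altSumBody` is solved by unification from the clauses of `altSum-unfold`, where the
-- list and the first test are with-abstracted to make that unification problem a pattern.
mutual
  altSumBody : ℕ → ℕ → ℕ → List ℕ → ℤ
  altSumBody = _

  altSum-unfold : ∀ n k j →
    altSum n (suc k) j ≡ signedIndicator (suc k) j 0 ℤ.* + 1 ℤ.+ altSumBody n k j (applyUpTo suc n)
  altSum-unfold n k j with applyUpTo suc n | 0 % suc k ≟ j
  ... | _ | yes _ = refl
  ... | _ | no  _ = refl

altSumBody-∷ : ∀ n k j y ys →
  altSumBody n k j (y ∷ ys) ≡ signedIndicator (suc k) j y ℤ.* + (n C y) ℤ.+ altSumBody n k j ys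
altSumBody-∷ n k j y ys with y % suc k ≟ j
... | yes _ = refl
... | no  _ = refl

altSumBody-applyUpTo : ∀ n k j (g : ℕ → ℕ) L →
  altSumBody n k j (applyUpTo g L) ≡ ∑ L (λ i → signedIndicator (suc k) j (g i) ℤ.* + (n C g i))
altSumBody-applyUpTo n k j g zero    = refl
altSumBody-applyUpTo n k j g (suc L) =
  trans (altSumBody-∷ n k j (g 0) (applyUpTo (g ∘ suc) L))
        (cong (ℤ._+_ (signedIndicator (suc k) j (g 0) ℤ.* + (n C g 0))) (altSumBody-applyUpTo n k j (g ∘ suc) L))

altSum≡binomialSum : ∀ n q j .{{_ : NonZero q}} → altSum n q j ≡ binomialSum (signedIndicator q j) n 0
altSum≡binomialSum n (suc k) j =
  trans (altSum-unfold n k j) (cong (ℤ._+_ (signedIndicator (suc k) j 0 ℤ.* + 1)) (altSumBody-applyUpTo n k j suc n))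

[k+1]*[n+1]C[k+1]≡[n+1]*nCk : ∀ n k → suc k * (suc n C suc k) ≡ suc n * (n C k)
[k+1]*[n+1]C[k+1]≡[n+1]*nCk zero    zero    = refl
[k+1]*[n+1]C[k+1]≡[n+1]*nCk zero    (suc k) = *-zeroʳ (suc (suc k))
[k+1]*[n+1]C[k+1]≡[n+1]*nCk (suc n) zero    =
  trans (*-identityˡ _) (trans (nC1≡n (suc (suc n))) (sym (*-identityʳ (suc (suc n)))))
[k+1]*[n+1]C[k+1]≡[n+1]*nCk (suc n) (suc k) = begin
  suc (suc k) * (suc (suc n) C suc (suc k))
    ≡⟨ cong (suc (suc k) *_) (nCk+nC[k+1]≡[n+1]C[k+1] (suc n) (suc k)) ⟨
  suc (suc k) * (a + b)
    ≡⟨ *-distribˡ-+ (suc (suc k)) a b ⟩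
  a + suc k * a + suc (suc k) * b
    ≡⟨ cong₂ (λ x y → a + x + y) ([k+1]*[n+1]C[k+1]≡[n+1]*nCk n k) ([k+1]*[n+1]C[k+1]≡[n+1]*nCk n (suc k)) ⟩
  a + suc n * (n C k) + suc n * (n C suc k)
    ≡⟨ +-assoc a _ _ ⟩
  a + (suc n * (n C k) + suc n * (n C suc k))
    ≡⟨ cong (_+_ a) (*-distribˡ-+ (suc n) (n C k) (n C suc k)) ⟨
  a + suc n * (n C k + n C suc k)
    ≡⟨ cong (λ c → a + suc n * c) (nCk+nC[k+1]≡[n+1]C[k+1] n k) ⟩
  a + suc n * a ∎
  where
  open ≡-Reasoning
  a = suc n C suc k
  b = suc n C suc (suc k)

n∣k*nCk : ∀ n k → n ℕ.∣ k * (n C k)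
n∣k*nCk zero    zero    = ℕ.∣-refl
n∣k*nCk zero    (suc k) = ℕ.divides 0 (*-zeroʳ (suc k))
n∣k*nCk (suc n) zero    = suc n ℕ.∣0
n∣k*nCk (suc n) (suc k) =
  ℕ.divides (n C k) (trans ([k+1]*[n+1]C[k+1]≡[n+1]*nCk n k) (*-comm (suc n) (n C k)))

p^k∣m*n⇒p^k∣m : ∀ {p n} → Prime p → ¬ p ℕ.∣ n → ∀ k {m} → p ^ k ℕ.∣ m * n → p ^ k ℕ.∣ m
p^k∣m*n⇒p^k∣m p-prime p∤n zero p^k∣mn = ℕ.1∣ _
p^k∣m*n⇒p^k∣m {p} {n} p-prime p∤n (suc k) {m} p^[1+k]∣mn
  with euclidsLemma m n p-prime (ℕ.∣-trans (ℕ.m∣m*n (p ^ k)) p^[1+k]∣mn)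
... | inj₂ p∣n = contradiction p∣n p∤n
... | inj₁ (ℕ.divides m′ refl) =
  subst (p ^ suc k ℕ.∣_) (*-comm p m′) (ℕ.*-monoʳ-∣ p (p^k∣m*n⇒p^k∣m p-prime p∤n k p^k∣m′n))
  where
  instance _ = prime⇒nonZero p-prime
  p^k∣m′n : p ^ k ℕ.∣ m′ * n
  p^k∣m′n = ℕ.*-cancelˡ-∣ p (subst (p ^ suc k ℕ.∣_)
    (trans (cong (_* n) (*-comm m′ p)) (*-assoc p m′ n)) p^[1+k]∣mn)

-- If p ∤ C(p^α, i) then p^α ∣ i, since p^α ∣ i · C(p^α, i).
prime^α-dividesInnerBinomials : ∀ {p} → Prime p → ∀ α → DividesInnerBinomials p (p ^ α)
prime^α-dividesInnerBinomials {p} p-prime α {i} 0<i i<p^α with p ℕ.∣? p ^ α C i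
... | yes p∣C = p∣C
... | no  p∤C = contradiction (ℕ.∣⇒≤ p^α∣i) (<⇒≱ i<p^α)
  where
  instance _ = >-nonZero 0<i
  p^α∣i : p ^ α ℕ.∣ i
  p^α∣i = p^k∣m*n⇒p^k∣m p-prime p∤C α (n∣k*nCk (p ^ α) i)

n/2≡⌊n/2⌋ : ∀ n → n / 2 ≡ ⌊ n /2⌋
n/2≡⌊n/2⌋ zero          = refl
n/2≡⌊n/2⌋ (suc zero)    = refl
n/2≡⌊n/2⌋ (suc (suc n)) = trans (m/n≡1+[m∸n]/n {suc (suc n)} (s≤s (s≤s z≤n))) (cong suc (n/2≡⌊n/2⌋ n))

roundDiv[n,2Q]≡⌈[n/Q]/2⌉ : ∀ n Q .{{_ : NonZero Q}} → roundDiv n (2 * Q) ≡ ⌈ n / Q /2⌉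
roundDiv[n,2Q]≡⌈[n/Q]/2⌉ n Q@(suc _) = begin
  (2 * n + 2 * Q) / (2 * (2 * Q)) ≡⟨ cong (_/ (2 * (2 * Q))) (*-distribˡ-+ 2 n Q) ⟨
  2 * (n + Q) / (2 * (2 * Q))     ≡⟨ m*n/m*o≡n/o 2 (n + Q) (2 * Q) ⟩
  (n + Q) / (2 * Q)               ≡⟨ /-congʳ {m = n + Q} (*-comm 2 Q) ⟩
  (n + Q) / (Q * 2)               ≡⟨ m/n/o≡m/[n*o] (n + Q) Q 2 ⟨
  (n + Q) / Q / 2                 ≡⟨ cong (_/ 2) ([m+n]/n≡1+m/n n Q) ⟩
  suc (n / Q) / 2                 ≡⟨ n/2≡⌊n/2⌋ (suc (n / Q)) ⟩
  ⌈ n / Q /2⌉                     ∎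
  where open ≡-Reasoning

roundDiv[n,2Q]+n/Q/p≤n/Q : ∀ n Q {p} .{{_ : NonZero Q}} .{{_ : NonZero p}} → 2 ≤ p →
  roundDiv n (2 * Q) + n / Q / p ≤ n / Q
roundDiv[n,2Q]+n/Q/p≤n/Q n Q {p} 2≤p = begin
  roundDiv n (2 * Q) + n / Q / p ≤⟨ +-monoʳ-≤ (roundDiv n (2 * Q)) (/-monoʳ-≤ (n / Q) 2≤p) ⟩
  roundDiv n (2 * Q) + n / Q / 2 ≡⟨ cong₂ _+_ (roundDiv[n,2Q]≡⌈[n/Q]/2⌉ n Q) (n/2≡⌊n/2⌋ (n / Q)) ⟩
  ⌈ n / Q /2⌉ + ⌊ n / Q /2⌋      ≡⟨ +-comm ⌈ n / Q /2⌉ ⌊ n / Q /2⌋ ⟩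
  ⌊ n / Q /2⌋ + ⌈ n / Q /2⌉      ≡⟨ ⌊n/2⌋+⌈n/2⌉≡n (n / Q) ⟩
  n / Q                          ∎
  where open ≤-Reasoning

sum-applyUpTo-telescoping : ∀ (f N : ℕ → ℕ) → (∀ t → f t + N (suc t) ≤ N t) →
  ∀ L → sum (applyUpTo f L) + N L ≤ N 0
sum-applyUpTo-telescoping f N step zero    = ≤-refl
sum-applyUpTo-telescoping f N step (suc L) = begin
  f 0 + sum (applyUpTo (f ∘ suc) L) + N (suc L)
    ≡⟨ +-assoc (f 0) (sum (applyUpTo (f ∘ suc) L)) (N (suc L)) ⟩
  f 0 + (sum (applyUpTo (f ∘ suc) L) + N (suc L))
    ≤⟨ +-monoʳ-≤ (f 0) (sum-applyUpTo-telescoping (f ∘ suc) (N ∘ suc) (step ∘ suc) L) ⟩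
  f 0 + N 1
    ≤⟨ step 0 ⟩
  N 0 ∎
  where open ≤-Reasoning

m≤n/o⇒m*o≤n : ∀ {m} n o .{{_ : NonZero o}} → m ≤ n / o → m * o ≤ n
m≤n/o⇒m*o≤n n o m≤n/o = ≤-trans (*-monoˡ-≤ o m≤n/o) (m/n*n≤m n o)

fExp*p^α≤n : ∀ n p α → 2 ≤ p → fExp n p α * p ^ α ≤ n
fExp*p^α≤n n p α 2≤p = m≤n/o⇒m*o≤n n (p ^ α) {{p^k≢0 α}} (begin
  fExp n p α                             ≡⟨ cong sum (map-upTo F (suc n)) ⟩
  sum (applyUpTo F (suc n))              ≤⟨ m≤m+n _ (N (suc n)) ⟩
  sum (applyUpTo F (suc n)) + N (suc n)  ≤⟨ sum-applyUpTo-telescoping F N step (suc n) ⟩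
  N 0                                    ≡⟨ cong (λ k → (n / p ^ k) {{p^k≢0 k}}) (+-identityʳ α) ⟩
  (n / p ^ α) {{p^k≢0 α}}                ∎)
  where
  open ≤-Reasoning
  instance
    p≢0 : NonZero p
    p≢0 = >-nonZero (≤-trans (s≤s z≤n) 2≤p)
  p^k≢0 : ∀ k → NonZero (p ^ k)
  p^k≢0 k = m^n≢0 p k
  F N : ℕ → ℕ
  F t = roundDiv n (2 * p ^ (α + t))
  N t = (n / p ^ (α + t)) {{p^k≢0 (α + t)}}
  step : ∀ t → F t + N (suc t) ≤ N t
  step t = subst (λ x → F t + x ≤ N t) n/Q/p≡N[1+t] (roundDiv[n,2Q]+n/Q/p≤n/Q n (p ^ (α + t)) 2≤p)
    where
    instance
      p^[α+t]≢0 : NonZero (p ^ (α + t))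
      p^[α+t]≢0 = p^k≢0 (α + t)
      p^[α+1+t]≢0 : NonZero (p ^ (α + suc t))
      p^[α+1+t]≢0 = p^k≢0 (α + suc t)
      p^[α+t]*p≢0 : NonZero (p ^ (α + t) * p)
      p^[α+t]*p≢0 = m*n≢0 (p ^ (α + t)) p
    n/Q/p≡N[1+t] : n / p ^ (α + t) / p ≡ N (suc t)
    n/Q/p≡N[1+t] = trans (m/n/o≡m/[n*o] n (p ^ (α + t)) p)
      (/-congʳ {m = n} (trans (*-comm (p ^ (α + t)) p) (cong (p ^_) (sym (+-suc α t)))))

roundDiv[n,2^[α+1]]*2^α≤n : ∀ n α → roundDiv n (2 ^ (α + 1)) * 2 ^ α ≤ n
roundDiv[n,2^[α+1]]*2^α≤n n α = m≤n/o⇒m*o≤n n (2 ^ α) (begin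
  roundDiv n (2 ^ (α + 1))                   ≡⟨ cong (λ k → roundDiv n (2 ^ k)) (+-comm α 1) ⟩
  roundDiv n (2 * 2 ^ α)                     ≤⟨ m≤m+n _ (n / 2 ^ α / 2) ⟩
  roundDiv n (2 * 2 ^ α) + n / 2 ^ α / 2     ≤⟨ roundDiv[n,2Q]+n/Q/p≤n/Q n (2 ^ α) ≤-refl ⟩
  n / 2 ^ α                                  ∎)
  where
  open ≤-Reasoning
  instance
    2^α≢0 : NonZero (2 ^ α)
    2^α≢0 = m^n≢0 2 α

prime-power-∣-altSum : ∀ {p} → Prime p → ∀ α e n j → e * p ^ α ≤ n → + (p ^ e) ∣ altSum n (p ^ α) j
prime-power-∣-altSum {p} p-prime α e n j e*p^α≤n =
  Signed.∣⇒∣ᵤ (subst (+ (p ^ e) Signed.∣_) (sym (altSum≡binomialSum n (p ^ α) j))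
    (p^t∣binomialSum {t = e} (signedIndicator-antiPeriodic (p ^ α) j)
      (prime^α-dividesInnerBinomials p-prime α) e*p^α≤n 0))
  where
  instance
    p^α≢0 : NonZero (p ^ α)
    p^α≢0 = m^n≢0 p α {{prime⇒nonZero p-prime}}

corollary5p2 :
    ((n α p j : ℕ) → 1 ≤ α → Prime p → ¬ (p ≡ 2) → j < p ^ α →
      (+ (p ^ fExp n p α)) ∣ altSum n (p ^ α) j)
    × ((n α j : ℕ) → 1 ≤ α → j < 2 ^ α →
      (+ (2 ^ roundDiv n (2 ^ (α + 1)))) ∣ altSum n (2 ^ α) j)
corollary5p2 =
    (λ n α p j _ p-prime _ _ → prime-power-∣-altSum p-prime α (fExp n p α) n j
      (fExp*p^α≤n n p α (nonTrivial⇒n>1 p {{prime⇒nonTrivial p-prime}})))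
  , (λ n α j _ _ → prime-power-∣-altSum prime[2] α (roundDiv n (2 ^ (α + 1))) n j (roundDiv[n,2^[α+1]]*2^α≤n n α))
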